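{- Let $X$ be a finite set with $|X|=n$ and let $S\subseteq X^3$ be an orthogonal array of degree $3$ and strength $2$ on $X$. For any $3$-coloring $c$ of $X$, $$2|M|-|R|=9\sigma_c^2\,n^2,$$ where $M$ and $R$ are the sets of monochromatic and rainbow vectors of $S$. In particular, $S$ contains at least $(9\sigma_c^2/2)n^2$ monochromatic vectors.
   Context: $S\subseteq X^3$ is an orthogonal array of degree 3 and strength 2 on $X$ if for any two distinct coordinate positions $i<j$ in $\{1,2,3\}$ and any $a,b\in X$ there is exactly one $(y_1,y_2,y_3)\in S$ with $y_i=a$, $y_j=b$. A vector is monochromatic if all its coordinates lie in the same color class, and rainbow if its three coordinates lie in three pairwise distinct color classes. For an $r$-coloring with color classes $X_1,\dots,X_r$ and densities $c_i=|X_i|/n$, its variance is $\sigma_c^2=\sum_{i=1}^r c_i^2/r-\big(\sum_{i=1}^r c_i/r\big)^2$ (here $r=3$). -}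

module Defs where

open import Data.Nat using (ℕ; zero; suc; NonZero)
open import Data.Fin using (Fin; zero; suc; toℕ; _≟_)
import Data.Nat as ℕ
open import Data.Bool using (Bool; true; false; _∧_; not)
open import Data.List using (List; []; _∷_; length; filterᵇ; allFin; concatMap; map; foldr)
open import Data.Product using (_×_; _,_; Σ; ∃)
open import Data.Integer using (+_)
open import Data.Rational using (ℚ; _/_; _+_; _*_; _-_)
open import Relation.Nullary.Decidable using (⌊_⌋)
open import Relation.Binary.PropositionalEquality using (_≡_)

Triple : ℕ → Set
Triple n = Fin n × Fin n × Fin n

-- coordinate i ∈ {1,2,3} (indexed 0,1,2) of a triple
coord : ∀ {n} → Fin 3 → Triple n → Fin n
coord zero          (a , b , c) = a
coord (suc zero)    (a , b , c) = b
coord (suc (suc zero)) (a , b , c) = c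

IsOrthogonalArray : ∀ {n} → (Triple n → Bool) → Set
IsOrthogonalArray {n} S =
  (i j : Fin 3) → toℕ i ℕ.< toℕ j → (a b : Fin n) →
  Σ (Triple n) λ y → (S y ≡ true × coord i y ≡ a × coord j y ≡ b) ×
    ((z : Triple n) → S z ≡ true → coord i z ≡ a → coord j z ≡ b → z ≡ y)

allTriples : (n : ℕ) → List (Triple n)
allTriples n = concatMap (λ a → concatMap (λ b → map (λ c → (a , b , c)) (allFin n)) (allFin n)) (allFin n)

Coloring : ℕ → Set
Coloring n = Fin n → Fin 3

eqᵇ : Fin 3 → Fin 3 → Bool
eqᵇ x y = ⌊ x ≟ y ⌋

isMono : ∀ {n} → Coloring n → Triple n → Bool
isMono c (a , b , d) = eqᵇ (c a) (c b) ∧ eqᵇ (c b) (c d)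

isRainbow : ∀ {n} → Coloring n → Triple n → Bool
isRainbow c (a , b , d) = not (eqᵇ (c a) (c b)) ∧ not (eqᵇ (c a) (c d)) ∧ not (eqᵇ (c b) (c d))

numMono : ∀ {n} → (Triple n → Bool) → Coloring n → ℕ
numMono {n} S c = length (filterᵇ (λ y → S y ∧ isMono c y) (allTriples n))

numRainbow : ∀ {n} → (Triple n → Bool) → Coloring n → ℕ
numRainbow {n} S c = length (filterᵇ (λ y → S y ∧ isRainbow c y) (allTriples n))

classSize : ∀ {n} → Coloring n → Fin 3 → ℕ
classSize {n} c i = length (filterᵇ (λ x → eqᵇ (c x) i) (allFin n))

density : ∀ {n} .{{_ : NonZero n}} → Coloring n → Fin 3 → ℚ
density {n} c i = (+ classSize c i) / n

sumℚ : List ℚ → ℚ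
sumℚ = foldr _+_ (+ 0 / 1)

variance : ∀ {n} .{{_ : NonZero n}} → Coloring n → ℚ
variance c =
  sumℚ (map (λ i → density c i * density c i) (allFin 3)) * (+ 1 / 3)
  - (sumℚ (map (density c) (allFin 3)) * (+ 1 / 3))
  * (sumℚ (map (density c) (allFin 3)) * (+ 1 / 3))

ℕtoℚ : ℕ → ℚ
ℕtoℚ m = (+ m) / 1

module Submission where

-- For three colours u, v, w one checks
--   2·[u = v = w] + 1 = [u, v, w pairwise distinct] + [u = v] + [u = w] + [v = w].
-- Summing over y ∈ S gives 2|M| + |S| = |R| + Σ_{i<j} #{y ∈ S : c yᵢ = c yⱼ}.  Strength 2 says
-- that for positions i < j every pair (a, b) ∈ X² is (yᵢ, yⱼ) for exactly one y ∈ S, so summing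
-- a function of (yᵢ, yⱼ) over S is summing it over X².  Hence |S| = n² and each of the three
-- pair counts is #{(a, b) : c a = c b} = Σₖ |Xₖ|² =: K, giving 2|M| − |R| = 3K − n².  With the
-- densities dₖ = |Xₖ|/n we have dₖ n = |Xₖ| and Σₖ |Xₖ| = n, so 9σ²n² = 3K − n² by algebra.
-- The bound follows from |R| ≥ 0.

open import Defs

module Counting where
  open import Data.Nat using (ℕ; zero; suc; _+_; _*_; _<_; z≤n; s≤s) renaming (_≟_ to _≟ℕ_)
  open import Data.Nat.Properties using (+-*-semiring; +-identityʳ; *-identityʳ; *-assoc; *-distribˡ-+)
  open import Data.Nat.Solver using (module +-*-Solver)
  open import Data.Bool using (Bool; true; false; _∧_; T?)
  open import Data.Fin using (Fin; zero; suc; toℕ; _≟_; punchIn)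
  open import Data.Fin.Properties using (punchInᵢ≢i; all?)
  open import Data.List using (List; _∷_; _++_; length; filterᵇ; map; concatMap; tabulate; allFin)
  open import Data.List.Properties using (length-++; filter-++; map-tabulate)
  open import Data.Product using (_,_; proj₁; proj₂)
  open import Data.Empty using (⊥-elim)
  open import Function using (id; _∘_)
  open import Relation.Nullary using (yes; no)
  open import Relation.Nullary.Decidable using (⌊_⌋; toWitness)
  open import Relation.Binary.PropositionalEquality
  open import Algebra.Properties.Semiring.Sum +-*-semiring
    using (sum; sum-syntax; sum-cong-≗; sum-remove; sum-replicate-zero;
           ∑-distrib-+; ∑-comm; *-distribˡ-sum; *-distribʳ-sum)
  open ≡-Reasoning

  ⟦_⟧ : Bool → ℕ
  ⟦ true ⟧  = 1
  ⟦ false ⟧ = 0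

  ⟦∧⟧ : ∀ p q → ⟦ p ∧ q ⟧ ≡ ⟦ p ⟧ * ⟦ q ⟧
  ⟦∧⟧ true  q = sym (+-identityʳ ⟦ q ⟧)
  ⟦∧⟧ false q = refl

  δ : ∀ {n} → Fin n → Fin n → ℕ
  δ x y = ⟦ ⌊ x ≟ y ⌋ ⟧

  δ-refl : ∀ {n} (x : Fin n) → δ x x ≡ 1
  δ-refl x with x ≟ x
  ... | yes _  = refl
  ... | no x≢x = ⊥-elim (x≢x refl)

  δ-off : ∀ {n} {x y : Fin n} → x ≢ y → δ x y ≡ 0
  δ-off {x = x} {y} x≢y with x ≟ y
  ... | yes x≡y = ⊥-elim (x≢y x≡y)
  ... | no _    = refl

  δ-sym : ∀ {n} (x y : Fin n) → δ x y ≡ δ y x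
  δ-sym x y with x ≟ y | y ≟ x
  ... | yes _   | yes _   = refl
  ... | no _    | no _    = refl
  ... | yes x≡y | no y≢x  = ⊥-elim (y≢x (sym x≡y))
  ... | no x≢y  | yes y≡x = ⊥-elim (x≢y (sym y≡x))

  ∑-zero : ∀ {n} (f : Fin n → ℕ) → (∀ x → f x ≡ 0) → sum f ≡ 0
  ∑-zero {n} f f≡0 = trans (sum-cong-≗ f≡0) (sum-replicate-zero n)

  ∑-supported : ∀ {n} (f : Fin n → ℕ) (x₀ : Fin n) → (∀ x → x ≢ x₀ → f x ≡ 0) → sum f ≡ f x₀
  ∑-supported {suc n} f x₀ off = begin
    sum f                                        ≡⟨ sum-remove f ⟩
    f x₀ + ∑[ x < n ] f (punchIn x₀ x)           ≡⟨ cong (f x₀ +_) (∑-zero _ off-x₀) ⟩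
    f x₀ + 0                                     ≡⟨ +-identityʳ (f x₀) ⟩
    f x₀                                         ∎
    where
    off-x₀ : ∀ x → f (punchIn x₀ x) ≡ 0
    off-x₀ x = off (punchIn x₀ x) (punchInᵢ≢i x₀ x)

  ∑-delta : ∀ {n} (x : Fin n) (g : Fin n → ℕ) → ∑[ a < n ] (δ x a * g a) ≡ g x
  ∑-delta {n} x g = begin
    ∑[ a < n ] (δ x a * g a)  ≡⟨ ∑-supported _ x (λ a a≢x → cong (_* g a) (δ-off (a≢x ∘ sym))) ⟩
    δ x x * g x             ≡⟨ cong (_* g x) (δ-refl x) ⟩
    1 * g x                 ≡⟨ +-identityʳ (g x) ⟩
    g x                     ∎

  ∑-one : ∀ n → ∑[ a < n ] 1 ≡ n
  ∑-one zero    = refl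
  ∑-one (suc n) = cong suc (∑-one n)

  ∑-product : ∀ {m n} (u : Fin m → ℕ) (v : Fin n → ℕ) →
    ∑[ a < m ] ∑[ b < n ] (u a * v b) ≡ sum u * sum v
  ∑-product u v = trans (sum-cong-≗ λ a → sym (*-distribˡ-sum (u a) v))
                        (sym (*-distribʳ-sum (sum v) u))

  classCount : ∀ {n r} → (Fin n → Fin r) → Fin r → ℕ
  classCount {n} c i = ∑[ a < n ] δ (c a) i

  ∑-classCount : ∀ {n r} (c : Fin n → Fin r) → ∑[ i < r ] classCount c i ≡ n
  ∑-classCount {n} {r} c = begin
    ∑[ i < r ] ∑[ a < n ] δ (c a) i      ≡⟨ ∑-comm (λ i a → δ (c a) i) ⟩
    ∑[ a < n ] ∑[ i < r ] δ (c a) i      ≡⟨ sum-cong-≗ one-colour ⟩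
    ∑[ a < n ] 1                         ≡⟨ ∑-one n ⟩
    n                                    ∎
    where
    one-colour : ∀ a → ∑[ i < r ] δ (c a) i ≡ 1
    one-colour a = trans (sum-cong-≗ λ i → sym (*-identityʳ (δ (c a) i))) (∑-delta (c a) (λ _ → 1))

  sameColourPairs : ∀ {n r} (c : Fin n → Fin r) →
    ∑[ a < n ] ∑[ b < n ] δ (c a) (c b) ≡ ∑[ i < r ] (classCount c i * classCount c i)
  sameColourPairs {n} {r} c = begin
    ∑[ a < n ] ∑[ b < n ] δ (c a) (c b)
      ≡⟨ sum-cong-≗ (λ a → sum-cong-≗ λ b → split a b) ⟩
    ∑[ a < n ] ∑[ b < n ] ∑[ i < r ] (δ (c a) i * δ (c b) i)
      ≡⟨ sum-cong-≗ (λ a → ∑-comm (λ b i → δ (c a) i * δ (c b) i)) ⟩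
    ∑[ a < n ] ∑[ i < r ] ∑[ b < n ] (δ (c a) i * δ (c b) i)
      ≡⟨ ∑-comm (λ a i → ∑[ b < n ] (δ (c a) i * δ (c b) i)) ⟩
    ∑[ i < r ] ∑[ a < n ] ∑[ b < n ] (δ (c a) i * δ (c b) i)
      ≡⟨ sum-cong-≗ (λ i → ∑-product (λ a → δ (c a) i) (λ b → δ (c b) i)) ⟩
    ∑[ i < r ] (classCount c i * classCount c i) ∎
    where
    split : ∀ a b → δ (c a) (c b) ≡ ∑[ i < r ] (δ (c a) i * δ (c b) i)
    split a b = trans (δ-sym (c a) (c b)) (sym (∑-delta (c a) (δ (c b))))

  count : ∀ {A : Set} → (A → Bool) → List A → ℕ
  count p xs = length (filterᵇ p xs)

  count-∷ : ∀ {A : Set} (p : A → Bool) x xs → count p (x ∷ xs) ≡ ⟦ p x ⟧ + count p xs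
  count-∷ p x xs with p x
  ... | true  = refl
  ... | false = refl

  count-++ : ∀ {A : Set} (p : A → Bool) xs ys → count p (xs ++ ys) ≡ count p xs + count p ys
  count-++ p xs ys = trans (cong length (filter-++ (T? ∘ p) xs ys)) (length-++ (filterᵇ p xs))

  count-tabulate : ∀ {A : Set} {n} (p : A → Bool) (f : Fin n → A) →
    count p (tabulate f) ≡ ∑[ i < n ] ⟦ p (f i) ⟧
  count-tabulate {n = zero}  p f = refl
  count-tabulate {n = suc n} p f =
    trans (count-∷ p (f zero) _) (cong (⟦ p (f zero) ⟧ +_) (count-tabulate p (f ∘ suc)))

  count-concatMap : ∀ {A B : Set} {n} (p : B → Bool) (g : A → List B) (f : Fin n → A) →
    count p (concatMap g (tabulate f)) ≡ ∑[ i < n ] count p (g (f i))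
  count-concatMap {n = zero}  p g f = refl
  count-concatMap {n = suc n} p g f =
    trans (count-++ p (g (f zero)) _) (cong (count p (g (f zero)) +_) (count-concatMap p g (f ∘ suc)))

  ∑₃ : ∀ {n} → (Triple n → ℕ) → ℕ
  ∑₃ {n} f = ∑[ a < n ] ∑[ b < n ] ∑[ d < n ] f (a , b , d)

  count-allTriples : ∀ {n} (p : Triple n → Bool) → count p (allTriples n) ≡ ∑₃ (λ y → ⟦ p y ⟧)
  count-allTriples {n} p =
    trans (count-concatMap p (λ a → concatMap (λ b → map (λ d → (a , b , d)) (allFin n)) (allFin n)) id)
    (sum-cong-≗ λ a → trans (count-concatMap p (λ b → map (λ d → (a , b , d)) (allFin n)) id)
    (sum-cong-≗ λ b → trans (cong (count p) (map-tabulate id (λ d → (a , b , d))))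
                            (count-tabulate p (λ d → (a , b , d)))))

  ∑₃-cong : ∀ {n} {f g : Triple n → ℕ} → (∀ y → f y ≡ g y) → ∑₃ f ≡ ∑₃ g
  ∑₃-cong f≡g = sum-cong-≗ λ a → sum-cong-≗ λ b → sum-cong-≗ λ d → f≡g (a , b , d)

  ∑₃-distrib-+ : ∀ {n} (f g : Triple n → ℕ) → ∑₃ (λ y → f y + g y) ≡ ∑₃ f + ∑₃ g
  ∑₃-distrib-+ {n} f g =
    trans (sum-cong-≗ λ a →
      trans (sum-cong-≗ λ b → ∑-distrib-+ (λ d → f (a , b , d)) (λ d → g (a , b , d)))
            (∑-distrib-+ (λ b → ∑[ d < n ] f (a , b , d)) (λ b → ∑[ d < n ] g (a , b , d))))
    (∑-distrib-+ (λ a → ∑[ b < n ] ∑[ d < n ] f (a , b , d))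
                 (λ a → ∑[ b < n ] ∑[ d < n ] g (a , b , d)))

  ∑₃-*ˡ : ∀ {n} k (f : Triple n → ℕ) → ∑₃ (λ y → k * f y) ≡ k * ∑₃ f
  ∑₃-*ˡ {n} k f = sym
    (trans (*-distribˡ-sum k (λ a → ∑[ b < n ] ∑[ d < n ] f (a , b , d))) (sum-cong-≗ λ a →
     trans (*-distribˡ-sum k (λ b → ∑[ d < n ] f (a , b , d))) (sum-cong-≗ λ b →
     *-distribˡ-sum k (λ d → f (a , b , d)))))

  ∑₃-comm : ∀ {n m} (G : Triple n → Fin m → ℕ) →
    ∑₃ (λ y → ∑[ x < m ] G y x) ≡ ∑[ x < m ] ∑₃ (λ y → G y x)
  ∑₃-comm {n} G =
    trans (sum-cong-≗ λ a →
      trans (sum-cong-≗ λ b → ∑-comm (λ d x → G (a , b , d) x))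
            (∑-comm (λ b x → ∑[ d < n ] G (a , b , d) x)))
    (∑-comm (λ a x → ∑[ b < n ] ∑[ d < n ] G (a , b , d) x))

  ∑₃-supported : ∀ {n} (f : Triple n → ℕ) (y₀ : Triple n) → (∀ y → y ≢ y₀ → f y ≡ 0) → ∑₃ f ≡ f y₀
  ∑₃-supported {n} f (a₀ , b₀ , d₀) off = begin
    ∑₃ f                                          ≡⟨ ∑-supported _ a₀ off-a₀ ⟩
    ∑[ b < n ] ∑[ d < n ] f (a₀ , b , d)          ≡⟨ ∑-supported _ b₀ off-b₀ ⟩
    ∑[ d < n ] f (a₀ , b₀ , d)                    ≡⟨ ∑-supported _ d₀ off-d₀ ⟩
    f (a₀ , b₀ , d₀)                              ∎
    where
    off-a₀ : ∀ a → a ≢ a₀ → ∑[ b < n ] ∑[ d < n ] f (a , b , d) ≡ 0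
    off-a₀ a a≢ = ∑-zero _ λ b → ∑-zero _ λ d → off (a , b , d) (a≢ ∘ cong proj₁)
    off-b₀ : ∀ b → b ≢ b₀ → ∑[ d < n ] f (a₀ , b , d) ≡ 0
    off-b₀ b b≢ = ∑-zero _ λ d → off (a₀ , b , d) (b≢ ∘ cong (proj₁ ∘ proj₂))
    off-d₀ : ∀ d → d ≢ d₀ → f (a₀ , b₀ , d) ≡ 0
    off-d₀ d d≢ = off (a₀ , b₀ , d) (d≢ ∘ cong (proj₂ ∘ proj₂))

  ∑-delta₂ : ∀ {n} (f : Fin n → Fin n → ℕ) (x y : Fin n) →
    ∑[ a < n ] ∑[ b < n ] (δ x a * δ y b * f a b) ≡ f x y
  ∑-delta₂ {n} f x y = begin
    ∑[ a < n ] ∑[ b < n ] (δ x a * δ y b * f a b)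
      ≡⟨ sum-cong-≗ (λ a → sum-cong-≗ λ b → *-assoc (δ x a) (δ y b) (f a b)) ⟩
    ∑[ a < n ] ∑[ b < n ] (δ x a * (δ y b * f a b))
      ≡⟨ sum-cong-≗ (λ a → sym (*-distribˡ-sum (δ x a) (λ b → δ y b * f a b))) ⟩
    ∑[ a < n ] (δ x a * ∑[ b < n ] (δ y b * f a b))
      ≡⟨ ∑-delta x (λ a → ∑[ b < n ] (δ y b * f a b)) ⟩
    ∑[ b < n ] (δ y b * f x b)
      ≡⟨ ∑-delta y (f x) ⟩
    f x y ∎

  module OrthogonalArray {n} (S : Triple n → Bool) where

    ∑∈S : (Triple n → ℕ) → ℕ
    ∑∈S f = ∑₃ (λ y → ⟦ S y ⟧ * f y)

    ∑∈S-cong : ∀ {f g : Triple n → ℕ} → (∀ y → f y ≡ g y) → ∑∈S f ≡ ∑∈S g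
    ∑∈S-cong f≡g = ∑₃-cong λ y → cong (⟦ S y ⟧ *_) (f≡g y)

    ∑∈S-+ : ∀ (f g : Triple n → ℕ) → ∑∈S (λ y → f y + g y) ≡ ∑∈S f + ∑∈S g
    ∑∈S-+ f g = trans (∑₃-cong λ y → *-distribˡ-+ ⟦ S y ⟧ (f y) (g y))
                      (∑₃-distrib-+ (λ y → ⟦ S y ⟧ * f y) (λ y → ⟦ S y ⟧ * g y))

    ∑∈S-*ˡ : ∀ k (f : Triple n → ℕ) → ∑∈S (λ y → k * f y) ≡ k * ∑∈S f
    ∑∈S-*ˡ k f = trans (∑₃-cong λ y → *-left-commute ⟦ S y ⟧ k (f y))
                       (∑₃-*ˡ k (λ y → ⟦ S y ⟧ * f y))
      where
      *-left-commute : ∀ s k x → s * (k * x) ≡ k * (s * x)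
      *-left-commute = solve 3 (λ s k x → s :* (k :* x) := k :* (s :* x)) refl
        where open +-*-Solver

    hits : Fin 3 → Fin 3 → Fin n → Fin n → Triple n → ℕ
    hits i j a b y = ⟦ S y ⟧ * (δ (coord i y) a * δ (coord j y) b)

    hits-unique : IsOrthogonalArray S → ∀ i j → toℕ i < toℕ j → ∀ a b → ∑₃ (hits i j a b) ≡ 1
    hits-unique oa i j i<j a b with oa i j i<j a b
    ... | y₀ , (Sy₀ , y₀i≡a , y₀j≡b) , unique = trans (∑₃-supported (hits i j a b) y₀ off) at-y₀
      where
      at-y₀ : hits i j a b y₀ ≡ 1
      at-y₀ rewrite Sy₀ | y₀i≡a | y₀j≡b | δ-refl a | δ-refl b = refl
      off : ∀ y → y ≢ y₀ → hits i j a b y ≡ 0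
      off y y≢y₀ with S y in Sy | coord i y ≟ a | coord j y ≟ b
      ... | false | _      | _      = refl
      ... | true  | no _   | _      = refl
      ... | true  | yes _  | no _   = refl
      ... | true  | yes yi | yes yj = ⊥-elim (y≢y₀ (unique y Sy yi yj))

    pair-sum : IsOrthogonalArray S → ∀ i j → toℕ i < toℕ j → (f : Fin n → Fin n → ℕ) →
      ∑∈S (λ y → f (coord i y) (coord j y)) ≡ ∑[ a < n ] ∑[ b < n ] f a b
    pair-sum oa i j i<j f = begin
      ∑∈S (λ y → f (coord i y) (coord j y))
        ≡⟨ ∑₃-cong expand ⟩
      ∑₃ (λ y → ∑[ a < n ] ∑[ b < n ] (f a b * hits i j a b y))
        ≡⟨ ∑₃-comm (λ y a → ∑[ b < n ] (f a b * hits i j a b y)) ⟩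
      ∑[ a < n ] ∑₃ (λ y → ∑[ b < n ] (f a b * hits i j a b y))
        ≡⟨ sum-cong-≗ (λ a → ∑₃-comm (λ y b → f a b * hits i j a b y)) ⟩
      ∑[ a < n ] ∑[ b < n ] ∑₃ (λ y → f a b * hits i j a b y)
        ≡⟨ sum-cong-≗ (λ a → sum-cong-≗ λ b → ∑₃-*ˡ (f a b) (hits i j a b)) ⟩
      ∑[ a < n ] ∑[ b < n ] (f a b * ∑₃ (hits i j a b))
        ≡⟨ sum-cong-≗ (λ a → sum-cong-≗ λ b →
             trans (cong (f a b *_) (hits-unique oa i j i<j a b)) (*-identityʳ (f a b))) ⟩
      ∑[ a < n ] ∑[ b < n ] f a b ∎
      where
      expand : ∀ y → ⟦ S y ⟧ * f (coord i y) (coord j y)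
                   ≡ ∑[ a < n ] ∑[ b < n ] (f a b * hits i j a b y)
      expand y = begin
        s * f yᵢ yⱼ
          ≡⟨ cong (s *_) (sym (∑-delta₂ f yᵢ yⱼ)) ⟩
        s * ∑[ a < n ] ∑[ b < n ] (δ yᵢ a * δ yⱼ b * f a b)
          ≡⟨ *-distribˡ-sum s (λ a → ∑[ b < n ] (δ yᵢ a * δ yⱼ b * f a b)) ⟩
        ∑[ a < n ] (s * ∑[ b < n ] (δ yᵢ a * δ yⱼ b * f a b))
          ≡⟨ sum-cong-≗ (λ a → *-distribˡ-sum s (λ b → δ yᵢ a * δ yⱼ b * f a b)) ⟩
        ∑[ a < n ] ∑[ b < n ] (s * (δ yᵢ a * δ yⱼ b * f a b))
          ≡⟨ sum-cong-≗ (λ a → sum-cong-≗ λ b → rearrange s (δ yᵢ a * δ yⱼ b) (f a b)) ⟩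
        ∑[ a < n ] ∑[ b < n ] (f a b * hits i j a b y) ∎
        where
        s = ⟦ S y ⟧
        yᵢ = coord i y
        yⱼ = coord j y
        rearrange : ∀ s p x → s * (p * x) ≡ x * (s * p)
        rearrange = solve 3 (λ s p x → s :* (p :* x) := x :* (s :* p)) refl
          where open +-*-Solver

  -- For three colours u, v, w:  2·[monochromatic] + 1 = [rainbow] + #(equal pairs).
  -- (All equal: 2+1 = 0+3; exactly one equal pair: 0+1 = 0+1; all distinct: 0+1 = 1+0.)
  colourPattern : ∀ (u v w : Fin 3) →
    2 * ⟦ isMono id (u , v , w) ⟧ + 1 ≡ ⟦ isRainbow id (u , v , w) ⟧ + (δ u v + δ u w + δ v w)
  colourPattern = toWitness {a? = all? λ u → all? λ v → all? λ w → _ ≟ℕ _} _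

  sameColour : ∀ {n} → Coloring n → ℕ
  sameColour c = ∑[ i < 3 ] (classSize c i * classSize c i)

  classSize≡classCount : ∀ {n} (c : Coloring n) i → classSize c i ≡ classCount c i
  classSize≡classCount c i = count-tabulate (λ x → eqᵇ (c x) i) id

  ∑-classSize : ∀ {n} (c : Coloring n) → ∑[ i < 3 ] classSize c i ≡ n
  ∑-classSize c = trans (sum-cong-≗ (classSize≡classCount c)) (∑-classCount c)

  module _ {n} (S : Triple n → Bool) (oa : IsOrthogonalArray S) (c : Coloring n) where
    open OrthogonalArray S

    count-in-S : ∀ (p : Triple n → Bool) →
      length (filterᵇ (λ y → S y ∧ p y) (allTriples n)) ≡ ∑∈S (λ y → ⟦ p y ⟧)
    count-in-S p = trans (count-allTriples (λ y → S y ∧ p y)) (∑₃-cong λ y → ⟦∧⟧ (S y) (p y))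

    size-S : ∑∈S (λ _ → 1) ≡ n * n
    size-S = begin
      ∑∈S (λ _ → 1)                            ≡⟨ pair-sum oa zero (suc zero) (s≤s z≤n) (λ _ _ → 1) ⟩
      ∑[ a < n ] ∑[ b < n ] 1                  ≡⟨ ∑-product {n} {n} (λ _ → 1) (λ _ → 1) ⟩
      (∑[ a < n ] 1) * (∑[ b < n ] 1)          ≡⟨ cong₂ _*_ (∑-one n) (∑-one n) ⟩
      n * n                                    ∎

    equalPairs : ∀ i j → toℕ i < toℕ j → ∑∈S (λ y → δ (c (coord i y)) (c (coord j y))) ≡ sameColour c
    equalPairs i j i<j =
      trans (pair-sum oa i j i<j (λ a b → δ (c a) (c b)))
     (trans (sameColourPairs c)
            (sum-cong-≗ λ i → sym (cong₂ _*_ (classSize≡classCount c i) (classSize≡classCount c i))))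

    countingIdentity : 2 * numMono S c + n * n ≡ numRainbow S c + (sameColour c + sameColour c + sameColour c)
    countingIdentity = begin
      2 * numMono S c + n * n
        ≡⟨ cong₂ (λ m s → 2 * m + s) (count-in-S (isMono c)) (sym size-S) ⟩
      2 * ∑∈S mono + ∑∈S (λ _ → 1)
        ≡⟨ cong (_+ ∑∈S (λ _ → 1)) (∑∈S-*ˡ 2 mono) ⟨
      ∑∈S (λ y → 2 * mono y) + ∑∈S (λ _ → 1)
        ≡⟨ ∑∈S-+ (λ y → 2 * mono y) (λ _ → 1) ⟨
      ∑∈S (λ y → 2 * mono y + 1)
        ≡⟨ ∑∈S-cong (λ { (a , b , d) → colourPattern (c a) (c b) (c d) }) ⟩
      ∑∈S (λ y → rainbow y + (e₀₁ y + e₀₂ y + e₁₂ y))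
        ≡⟨ ∑∈S-+ rainbow (λ y → e₀₁ y + e₀₂ y + e₁₂ y) ⟩
      ∑∈S rainbow + ∑∈S (λ y → e₀₁ y + e₀₂ y + e₁₂ y)
        ≡⟨ cong (∑∈S rainbow +_) (trans (∑∈S-+ (λ y → e₀₁ y + e₀₂ y) e₁₂)
                                        (cong (_+ ∑∈S e₁₂) (∑∈S-+ e₀₁ e₀₂))) ⟩
      ∑∈S rainbow + (∑∈S e₀₁ + ∑∈S e₀₂ + ∑∈S e₁₂)
        ≡⟨ cong₂ _+_ (sym (count-in-S (isRainbow c)))
                     (cong₂ _+_ (cong₂ _+_ (equalPairs zero (suc zero) (s≤s z≤n))
                                           (equalPairs zero (suc (suc zero)) (s≤s z≤n)))
                                (equalPairs (suc zero) (suc (suc zero)) (s≤s (s≤s z≤n)))) ⟩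
      numRainbow S c + (sameColour c + sameColour c + sameColour c) ∎
      where
      mono rainbow e₀₁ e₀₂ e₁₂ : Triple n → ℕ
      mono y    = ⟦ isMono c y ⟧
      rainbow y = ⟦ isRainbow c y ⟧
      e₀₁ y = δ (c (coord zero y)) (c (coord (suc zero) y))
      e₀₂ y = δ (c (coord zero y)) (c (coord (suc (suc zero)) y))
      e₁₂ y = δ (c (coord (suc zero) y)) (c (coord (suc (suc zero)) y))

module Rationals where
  open import Data.Nat as ℕ using (ℕ; suc)
  open import Data.Fin using (Fin; zero; suc)
  open import Data.Integer as ℤ using (+_)
  import Data.Integer.Properties as ℤₚ
  import Data.Nat.Properties as ℕₚ
  open import Data.Rational using (ℚ; _/_; _+_; _*_; _-_; -_; _≤_; 0ℚ; fromℚᵘ; nonNegative)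
  open import Data.Rational.Properties
  import Data.Rational.Unnormalised as ℚᵘ
  import Data.Rational.Unnormalised.Properties as ℚᵘₚ
  open import Data.Rational.Solver using (module +-*-Solver)
  open import Function using (_∘_)
  open import Relation.Binary.PropositionalEquality
  import Algebra.Properties.Semiring.Sum as SemiringSum
  open import Algebra.Bundles using (Ring)
  open SemiringSum (Ring.semiring +-*-ring) using (sum; sum-cong-≗)
  module ℕΣ = SemiringSum ℕₚ.+-*-semiring

  fromℚᵘ-+ : ∀ p q → fromℚᵘ (p ℚᵘ.+ q) ≡ fromℚᵘ p + fromℚᵘ q
  fromℚᵘ-+ p q = toℚᵘ-injective (ℚᵘₚ.≃-sym (ℚᵘₚ.≃-trans (toℚᵘ-homo-+ (fromℚᵘ p) (fromℚᵘ q))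
    (ℚᵘₚ.≃-trans (ℚᵘₚ.+-cong (toℚᵘ-fromℚᵘ p) (toℚᵘ-fromℚᵘ q)) (ℚᵘₚ.≃-sym (toℚᵘ-fromℚᵘ (p ℚᵘ.+ q))))))

  fromℚᵘ-* : ∀ p q → fromℚᵘ (p ℚᵘ.* q) ≡ fromℚᵘ p * fromℚᵘ q
  fromℚᵘ-* p q = toℚᵘ-injective (ℚᵘₚ.≃-sym (ℚᵘₚ.≃-trans (toℚᵘ-homo-* (fromℚᵘ p) (fromℚᵘ q))
    (ℚᵘₚ.≃-trans (ℚᵘₚ.*-cong (toℚᵘ-fromℚᵘ p) (toℚᵘ-fromℚᵘ q)) (ℚᵘₚ.≃-sym (toℚᵘ-fromℚᵘ (p ℚᵘ.* q))))))

  -- ℕtoℚ m is the normalisation of the unnormalised fraction m/1.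
  ℕtoℚᵘ : ℕ → ℚᵘ.ℚᵘ
  ℕtoℚᵘ m = ℚᵘ.mkℚᵘ (+ m) 0

  ℕtoℚ-+ : ∀ a b → ℕtoℚ (a ℕ.+ b) ≡ ℕtoℚ a + ℕtoℚ b
  ℕtoℚ-+ a b = trans (fromℚᵘ-cong {ℕtoℚᵘ (a ℕ.+ b)} {ℕtoℚᵘ a ℚᵘ.+ ℕtoℚᵘ b} (ℚᵘ.*≡* numerators)) (fromℚᵘ-+ (ℕtoℚᵘ a) (ℕtoℚᵘ b))
    where
    open ≡-Reasoning
    numerators : + (a ℕ.+ b) ℤ.* + 1 ≡ (+ a ℤ.* + 1 ℤ.+ + b ℤ.* + 1) ℤ.* + 1
    numerators = begin
      + (a ℕ.+ b) ℤ.* + 1                  ≡⟨ ℤₚ.*-identityʳ (+ (a ℕ.+ b)) ⟩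
      + (a ℕ.+ b)                          ≡⟨ ℤₚ.pos-+ a b ⟩
      + a ℤ.+ + b                          ≡⟨ cong₂ ℤ._+_ (ℤₚ.*-identityʳ (+ a)) (ℤₚ.*-identityʳ (+ b)) ⟨
      + a ℤ.* + 1 ℤ.+ + b ℤ.* + 1          ≡⟨ ℤₚ.*-identityʳ (+ a ℤ.* + 1 ℤ.+ + b ℤ.* + 1) ⟨
      (+ a ℤ.* + 1 ℤ.+ + b ℤ.* + 1) ℤ.* + 1 ∎

  ℕtoℚ-* : ∀ a b → ℕtoℚ (a ℕ.* b) ≡ ℕtoℚ a * ℕtoℚ b
  ℕtoℚ-* a b = trans (fromℚᵘ-cong {ℕtoℚᵘ (a ℕ.* b)} {ℕtoℚᵘ a ℚᵘ.* ℕtoℚᵘ b} (ℚᵘ.*≡* numerators)) (fromℚᵘ-* (ℕtoℚᵘ a) (ℕtoℚᵘ b))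
    where
    numerators : + (a ℕ.* b) ℤ.* + 1 ≡ (+ a ℤ.* + b) ℤ.* + 1
    numerators = cong (ℤ._* + 1) (ℤₚ.pos-* a b)

  ℕtoℚ-∑ : ∀ {r} (f : Fin r → ℕ) → ℕtoℚ (ℕΣ.sum f) ≡ sum (ℕtoℚ ∘ f)
  ℕtoℚ-∑ {0}     f = refl
  ℕtoℚ-∑ {suc r} f = trans (ℕtoℚ-+ (f zero) (ℕΣ.sum (f ∘ suc))) (cong (λ t → ℕtoℚ (f zero) + t) (ℕtoℚ-∑ (f ∘ suc)))

  density-scaled : ∀ k m → (+ k) / suc m * ℕtoℚ (suc m) ≡ ℕtoℚ k
  density-scaled k m = trans (sym (fromℚᵘ-* (ℚᵘ.mkℚᵘ (+ k) m) (ℕtoℚᵘ (suc m))))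
                             (fromℚᵘ-cong {ℚᵘ.mkℚᵘ (+ k) m ℚᵘ.* ℕtoℚᵘ (suc m)} {ℕtoℚᵘ k}
                               (ℚᵘ.*≡* cross-multiplied))
    where
    cross-multiplied : (+ k ℤ.* + suc m) ℤ.* + 1 ≡ + k ℤ.* + suc (m ℕ.* 1)
    cross-multiplied rewrite ℕₚ.*-identityʳ m | ℤₚ.*-identityʳ (+ k ℤ.* + suc m) = refl

  nineVariance : ∀ (d : Fin 3 → ℚ) (N : ℚ) →
    (+ 9 / 1) * (sum (λ i → d i * d i) * (+ 1 / 3) - (sum d * (+ 1 / 3)) * (sum d * (+ 1 / 3))) * (N * N)
      ≡ (let S₂ = sum (λ i → (d i * N) * (d i * N)) in S₂ + S₂ + S₂)
        - sum (λ i → d i * N) * sum (λ i → d i * N)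
  nineVariance d N = identity (d zero) (d (suc zero)) (d (suc (suc zero))) N
    where
    open +-*-Solver
    identity : ∀ d₀ d₁ d₂ N →
      (+ 9 / 1) * ((d₀ * d₀ + (d₁ * d₁ + (d₂ * d₂ + 0ℚ))) * (+ 1 / 3)
                   - ((d₀ + (d₁ + (d₂ + 0ℚ))) * (+ 1 / 3)) * ((d₀ + (d₁ + (d₂ + 0ℚ))) * (+ 1 / 3))) * (N * N)
      ≡ (let S₂ = (d₀ * N) * (d₀ * N) + ((d₁ * N) * (d₁ * N) + ((d₂ * N) * (d₂ * N) + 0ℚ)) in S₂ + S₂ + S₂)
        - (d₀ * N + (d₁ * N + (d₂ * N + 0ℚ))) * (d₀ * N + (d₁ * N + (d₂ * N + 0ℚ)))
    identity = solve 4 (λ d₀ d₁ d₂ N →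
      let z = con 0ℚ ; third = con (+ 1 / 3)
          S₁ = d₀ :+ (d₁ :+ (d₂ :+ z))
          S₂ = (d₀ :* N) :* (d₀ :* N) :+ ((d₁ :* N) :* (d₁ :* N) :+ ((d₂ :* N) :* (d₂ :* N) :+ z))
          T  = d₀ :* N :+ (d₁ :* N :+ (d₂ :* N :+ z)) in
      con (+ 9 / 1) :* ((d₀ :* d₀ :+ (d₁ :* d₁ :+ (d₂ :* d₂ :+ z))) :* third :- (S₁ :* third) :* (S₁ :* third)) :* (N :* N)
        := S₂ :+ S₂ :+ S₂ :- T :* T) refl

  difference-of-sums : ∀ a b c d → a + d ≡ b + c → a - b ≡ c - d
  difference-of-sums a b c d a+d≡b+c = begin
    a - b               ≡⟨ shift a b d ⟩
    (a + d) - (b + d)   ≡⟨ cong (_- (b + d)) a+d≡b+c ⟩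
    (b + c) - (b + d)   ≡⟨ cancel b c d ⟩
    c - d               ∎
    where
    open ≡-Reasoning
    open +-*-Solver
    shift : ∀ a b d → a - b ≡ (a + d) - (b + d)
    shift = solve 3 (λ a b d → a :- b := (a :+ d) :- (b :+ d)) refl
    cancel : ∀ b c d → (b + c) - (b + d) ≡ c - d
    cancel = solve 3 (λ b c d → (b :+ c) :- (b :+ d) := c :- d) refl

  ℕtoℚ-nonNegative : ∀ k → 0ℚ ≤ ℕtoℚ k
  ℕtoℚ-nonNegative k = nonNegative⁻¹ (ℕtoℚ k) {{normalize-nonNeg k 1}}

  half-bound : ∀ M R v t → 0ℚ ≤ R → (+ 2 / 1) * M - R ≡ (+ 9 / 1) * v * t → (+ 9 / 2) * v * t ≤ M
  half-bound M R v t 0≤R 2M-R≡9vt = begin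
    (+ 9 / 2) * v * t                   ≡⟨ halve v t ⟩
    (+ 1 / 2) * ((+ 9 / 1) * v * t)     ≡⟨ cong ((+ 1 / 2) *_) 2M-R≡9vt ⟨
    (+ 1 / 2) * ((+ 2 / 1) * M - R)     ≡⟨ halve-difference M R ⟩
    M - (+ 1 / 2) * R                   ≤⟨ +-monoʳ-≤ M (neg-antimono-≤ 0≤R/2) ⟩
    M + - 0ℚ                            ≡⟨ +-identityʳ M ⟩
    M                                   ∎
    where
    open ≤-Reasoning
    open +-*-Solver
    halve : ∀ v t → (+ 9 / 2) * v * t ≡ (+ 1 / 2) * ((+ 9 / 1) * v * t)
    halve = solve 2 (λ v t → con (+ 9 / 2) :* v :* t := con (+ 1 / 2) :* (con (+ 9 / 1) :* v :* t)) refl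
    halve-difference : ∀ M R → (+ 1 / 2) * ((+ 2 / 1) * M - R) ≡ M - (+ 1 / 2) * R
    halve-difference = solve 2 (λ M R → con (+ 1 / 2) :* (con (+ 2 / 1) :* M :- R) := M :- con (+ 1 / 2) :* R) refl
    0≤R/2 : 0ℚ ≤ (+ 1 / 2) * R
    0≤R/2 = nonNegative⁻¹ _ {{nonNeg*nonNeg⇒nonNeg (+ 1 / 2) R {{nonNegative 0≤R}}}}

open import Data.Nat as ℕ using (ℕ; NonZero)
open import Data.Bool using (Bool)
open import Data.Product using (_×_; _,_)
open import Data.Integer using (+_)
open import Data.Rational using (_/_; _+_; _*_; _-_; _≤_)
open import Data.Rational.Properties using (+-*-ring)
open import Algebra.Bundles using (Ring)
open import Algebra.Properties.Semiring.Sum (Ring.semiring +-*-ring) using (sum; sum-cong-≗)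
open import Relation.Binary.PropositionalEquality using (_≡_; sym; trans; cong; cong₂; module ≡-Reasoning)
open Counting using (countingIdentity; sameColour; ∑-classSize)
open Rationals

countingIdentityℚ : ∀ {n} (S : Triple n → Bool) → IsOrthogonalArray S → (c : Coloring n) →
  let K = ℕtoℚ (sameColour c) in
  (+ 2 / 1) * ℕtoℚ (numMono S c) + ℕtoℚ n * ℕtoℚ n ≡ ℕtoℚ (numRainbow S c) + (K + K + K)
countingIdentityℚ {n} S oa c = begin
  (+ 2 / 1) * ℕtoℚ M + ℕtoℚ n * ℕtoℚ n    ≡⟨ cong₂ _+_ (ℕtoℚ-* 2 M) (ℕtoℚ-* n n) ⟨
  ℕtoℚ (2 ℕ.* M) + ℕtoℚ (n ℕ.* n)        ≡⟨ ℕtoℚ-+ (2 ℕ.* M) (n ℕ.* n) ⟨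
  ℕtoℚ (2 ℕ.* M ℕ.+ n ℕ.* n)             ≡⟨ cong ℕtoℚ (countingIdentity S oa c) ⟩
  ℕtoℚ (R ℕ.+ (k ℕ.+ k ℕ.+ k))           ≡⟨ ℕtoℚ-+ R (k ℕ.+ k ℕ.+ k) ⟩
  ℕtoℚ R + ℕtoℚ (k ℕ.+ k ℕ.+ k)          ≡⟨ cong (λ t → ℕtoℚ R + t) (trans (ℕtoℚ-+ (k ℕ.+ k) k)
                                                               (cong (_+ ℕtoℚ k) (ℕtoℚ-+ k k))) ⟩
  ℕtoℚ R + (ℕtoℚ k + ℕtoℚ k + ℕtoℚ k)    ∎
  where
  open ≡-Reasoning
  M = numMono S c
  R = numRainbow S c
  k = sameColour c

scaledVariance : ∀ m (c : Coloring (ℕ.suc m)) →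
  let N = ℕtoℚ (ℕ.suc m) ; K = ℕtoℚ (sameColour c) in
  (+ 9 / 1) * variance c * (N * N) ≡ K + K + K - N * N
scaledVariance m c = begin
  (+ 9 / 1) * variance c * (N * N)              ≡⟨ nineVariance (density c) N ⟩
  S₂ + S₂ + S₂ - S₁ * S₁                        ≡⟨ cong₂ (λ s t → s + s + s - t * t) squares total ⟩
  K + K + K - N * N                             ∎
  where
  open ≡-Reasoning
  N = ℕtoℚ (ℕ.suc m)
  K = ℕtoℚ (sameColour c)
  S₁ = sum (λ i → density c i * N)
  S₂ = sum (λ i → (density c i * N) * (density c i * N))
  scaled : ∀ i → density c i * N ≡ ℕtoℚ (classSize c i)
  scaled i = density-scaled (classSize c i) m
  squares : S₂ ≡ K
  squares = trans (sum-cong-≗ λ i → trans (cong₂ _*_ (scaled i) (scaled i))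
                                          (sym (ℕtoℚ-* (classSize c i) (classSize c i))))
                  (sym (ℕtoℚ-∑ (λ i → classSize c i ℕ.* classSize c i)))
  total : S₁ ≡ N
  total = trans (sum-cong-≗ scaled) (trans (sym (ℕtoℚ-∑ (classSize c))) (cong ℕtoℚ (∑-classSize c)))

corollary3p5 : (n : ℕ) .{{_ : NonZero n}} (S : Triple n → Bool) →
    IsOrthogonalArray S → (c : Coloring n) →
    ((+ 2 / 1) * ℕtoℚ (numMono S c) - ℕtoℚ (numRainbow S c)
       ≡ (+ 9 / 1) * variance c * (ℕtoℚ n * ℕtoℚ n))
    × ((+ 9 / 2) * variance c * (ℕtoℚ n * ℕtoℚ n) ≤ ℕtoℚ (numMono S c))
corollary3p5 (ℕ.suc m) S oa c = identity , bound
  where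
  N = ℕtoℚ (ℕ.suc m)
  M = ℕtoℚ (numMono S c)
  R = ℕtoℚ (numRainbow S c)
  K = ℕtoℚ (sameColour c)
  identity : (+ 2 / 1) * M - R ≡ (+ 9 / 1) * variance c * (N * N)
  identity = trans (difference-of-sums ((+ 2 / 1) * M) R (K + K + K) (N * N) (countingIdentityℚ S oa c))
                   (sym (scaledVariance m c))
  bound : (+ 9 / 2) * variance c * (N * N) ≤ M
  bound = half-bound M R (variance c) (N * N) (ℕtoℚ-nonNegative (numRainbow S c)) identity
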